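{- Let $\sigma\in B_n$ and suppose that in the window notation $[\sigma(1)\cdots\sigma(n)]$ the letter $\alpha$ occurs in the $j$-th position, i.e. $\sigma(j)=\alpha$. Then $\alpha$ appears in the first $n+1-j$ columns of the key tableau $K(\sigma)$.
   Context: $[\pm n]=\{1,\dots,n,\overline n,\dots,\overline1\}$ ($\overline i=-i$), ordered $1<\dots<n<\overline n<\dots<\overline1$. $B_n$ is the group of bijections $\sigma$ of $[\pm n]$ with $\sigma(\overline i)=\overline{\sigma(i)}$, acting on $\mathbb Z^n$ by $\sigma v=(\mathrm{sgn}(\sigma^{ -1}(1))v_{|\sigma^{ -1}(1)|},\dots,\mathrm{sgn}(\sigma^{ -1}(n))v_{|\sigma^{ -1}(n)|})$. A key tableau is a semistandard tableau of partition shape with entries in $[\pm n]$ such that the entry set of each column contains that of the next column to its right and no $i$ has both $i,\overline i$ as entries; its weight has $i$-th entry (number of $i$'s) minus (number of $\overline i$'s). $K(v)$ denotes the unique key tableau of weight $v$, and $K(\sigma):=K(\sigma\Delta^n)$ with $\Delta^n=(n,n-1,\dots,1)$. -}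

module Defs where

open import Data.Nat as ℕ using (ℕ; zero; suc; _∸_; _+_)
open import Data.Integer as ℤ using (ℤ; +_; -_)
open import Data.Fin using (Fin; toℕ)
open import Data.Fin.Permutation using (Permutation′; _⟨$⟩ʳ_; _⟨$⟩ˡ_)
open import Data.Bool using (Bool; true; false; if_then_else_)
open import Data.List using (List; []; _∷_; concat; length; filter; drop)
open import Data.List.Membership.Propositional using (_∈_)
open import Data.List.Relation.Unary.Linked using (Linked)
open import Data.Product using (_×_; Σ)
open import Data.Unit using (⊤)
open import Data.Empty using (⊥)
open import Data.Maybe using (Maybe; just; nothing)
open import Relation.Nullary using (¬_; yes; no)
open import Relation.Binary.PropositionalEquality using (_≡_)
import Data.Fin as F

-- The alphabet [±n] = {1,…,n, n̄,…,1̄}.  Letters are 0-indexed: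
-- pos i stands for i+1, neg i for the barred letter \overline{i+1}.

data Letter (n : ℕ) : Set where
  pos : Fin n → Letter n
  neg : Fin n → Letter n

bar : ∀ {n} → Letter n → Letter n
bar (pos i) = neg i
bar (neg i) = pos i

-- rank realising the order 1 < … < n < n̄ < … < 1̄
rank : ∀ {n} → Letter n → ℕ
rank {n} (pos i) = toℕ i
rank {n} (neg i) = n + (n ∸ suc (toℕ i))

_<L_ : ∀ {n} → Letter n → Letter n → Set
x <L y = rank x ℕ.< rank y

_≤L_ : ∀ {n} → Letter n → Letter n → Set
x ≤L y = rank x ℕ.≤ rank y

_≟L_ : ∀ {n} (x y : Letter n) → Relation.Nullary.Dec (x ≡ y)
pos i ≟L pos j with i F.≟ j
... | yes Relation.Binary.PropositionalEquality.refl = yes Relation.Binary.PropositionalEquality.refl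
... | no p = no λ { Relation.Binary.PropositionalEquality.refl → p Relation.Binary.PropositionalEquality.refl }
pos i ≟L neg j = no λ ()
neg i ≟L pos j = no λ ()
neg i ≟L neg j with i F.≟ j
... | yes Relation.Binary.PropositionalEquality.refl = yes Relation.Binary.PropositionalEquality.refl
... | no p = no λ { Relation.Binary.PropositionalEquality.refl → p Relation.Binary.PropositionalEquality.refl }

-- Signed permutations B_n.  σ is given by a permutation π of {1..n}
-- and signs ε (true = negative): σ(j) = ε_j · π(j), σ(j̄) = \overline{σ(j)}.
-- Every bijection of [±n] commuting with bar is of this form.

record SignedPerm (n : ℕ) : Set where
  constructor signedPerm
  field
    perm : Permutation′ n
    negSign : Fin n → Bool

signed : ∀ {n} → Bool → Fin n → Letter n
signed true i = neg i
signed false i = pos i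

apply : ∀ {n} → SignedPerm n → Letter n → Letter n
apply σ (pos j) = signed (SignedPerm.negSign σ j) (SignedPerm.perm σ ⟨$⟩ʳ j)
apply σ (neg j) = bar (apply σ (pos j))

applyInv : ∀ {n} → SignedPerm n → Letter n → Letter n
applyInv σ (pos k) = signed (SignedPerm.negSign σ (SignedPerm.perm σ ⟨$⟩ˡ k)) (SignedPerm.perm σ ⟨$⟩ˡ k)
applyInv σ (neg k) = bar (applyInv σ (pos k))

window : ∀ {n} → SignedPerm n → Fin n → Letter n
window σ j = apply σ (pos j)

sgn : ∀ {n} → Letter n → ℤ → ℤ
sgn (pos _) z = z
sgn (neg _) z = - z

absL : ∀ {n} → Letter n → Fin n
absL (pos i) = i
absL (neg i) = i

act : ∀ {n} → SignedPerm n → (Fin n → ℤ) → (Fin n → ℤ)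
act σ v k = sgn (applyInv σ (pos k)) (v (absL (applyInv σ (pos k))))

Δ : (n : ℕ) → Fin n → ℤ
Δ n i = + (n ∸ toℕ i)

-- Tableaux, stored as the list of their columns from left to right;
-- each column is listed from top to bottom.

Column : ℕ → Set
Column n = List (Letter n)

Tableau : ℕ → Set
Tableau n = List (Column n)

NonEmpty : ∀ {n} → Column n → Set
NonEmpty [] = ⊥
NonEmpty (_ ∷ _) = ⊤

RowsWeak : ∀ {n} → Column n → Column n → Set
RowsWeak _ [] = ⊤
RowsWeak [] (_ ∷ _) = ⊥
RowsWeak (x ∷ xs) (y ∷ ys) = (x ≤L y) × RowsWeak xs ys

-- semistandard of partition shape: nonempty columns of weakly
-- decreasing length, columns strictly increasing, rows weakly increasing
IsSSYT : ∀ {n} → Tableau n → Set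
IsSSYT T =
  (∀ {C} → C ∈ T → NonEmpty C × Linked _<L_ C) × Linked RowsWeak T

entries : ∀ {n} → Tableau n → List (Letter n)
entries = concat

Contains : ∀ {n} → Column n → Column n → Set
Contains C C' = ∀ {x} → x ∈ C' → x ∈ C

IsKeyTableau : ∀ {n} → Tableau n → Set
IsKeyTableau {n} T =
  IsSSYT T × Linked Contains T ×
  (∀ (i : Fin n) → ¬ (pos i ∈ entries T × neg i ∈ entries T))

count : ∀ {n} → Letter n → List (Letter n) → ℕ
count x xs = length (filter (_≟L x) xs)

weight : ∀ {n} → Tableau n → Fin n → ℤ
weight T i = + count (pos i) (entries T) ℤ.- + count (neg i) (entries T)

-- the c-th column (0-indexed) if it exists
columnAt : ∀ {n} → Tableau n → ℕ → Maybe (Column n)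
columnAt [] _ = nothing
columnAt (C ∷ _) zero = just C
columnAt (_ ∷ T) (suc c) = columnAt T c

-- In a key tableau of weight σΔⁿ the letter α = σ(j) has weight sgn(α)·(n+1−j) at |α|,
-- and since a key tableau never contains both i and ī, α occurs exactly n+1−j times.
-- Columns strictly increase, so each column contains α at most once; columns are
-- nested, so the columns containing α form an initial segment.  Hence they are
-- exactly the first n+1−j columns.
module Submission where

open import Defs
open import Data.Nat using (ℕ; _<_; _∸_; _≤_; zero; suc; _+_; z≤n; s≤s)
open import Data.Nat.Properties using (<-trans; <-irrefl; ≮⇒≥; +-monoˡ-≤; ≤-trans; +-cancelˡ-<)
open import Data.Fin using (Fin; toℕ)
open import Data.Fin.Permutation using (inverseˡ)
open import Data.Bool using (true; false)
open import Data.Integer as ℤ using (ℤ; +_; -_)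
open import Data.Integer.Properties using (+-injective; neg-injective; +-identityˡ; +-identityʳ)
open import Data.Product using (Σ; _×_; _,_; proj₂)
open import Data.Maybe using (just)
open import Data.Empty using (⊥; ⊥-elim)
open import Data.List using ([]; _∷_; _++_; filter; length; concat)
open import Data.List.Membership.Propositional using (_∈_)
open import Data.List.Membership.Propositional.Properties using (∈-concat⁻′)
open import Data.List.Properties using (filter-++; length-++)
open import Data.List.Relation.Unary.Any using (here; there)
open import Data.List.Relation.Unary.All as All using (All)
open import Data.List.Relation.Unary.AllPairs using (_∷_)
open import Data.List.Relation.Unary.Linked using (Linked; tail)
open import Data.List.Relation.Unary.Linked.Properties using (Linked⇒AllPairs)
open import Function using (_∘_)
open import Relation.Nullary using (yes; no; ¬_)
open import Relation.Binary.PropositionalEquality using (_≡_; refl; sym; trans; cong; subst)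

count>0⇒∈ : ∀ {n} {a : Letter n} {xs} → 0 < count a xs → a ∈ xs
count>0⇒∈ {a = a} {x ∷ xs} p with x ≟L a
... | yes refl = here refl
... | no _ = there (count>0⇒∈ p)

count-++ : ∀ {n} (a : Letter n) xs ys → count a (xs ++ ys) ≡ count a xs + count a ys
count-++ a xs ys = trans (cong length (filter-++ (_≟L a) xs ys)) (length-++ (filter (_≟L a) xs))

count-strict≤1 : ∀ {n} (a : Letter n) C → Linked _<L_ C → count a C ≤ 1
count-strict≤1 a [] _ = z≤n
count-strict≤1 a (x ∷ xs) l with x ≟L a
... | yes refl = s≤s (≮⇒≥ (x∉xs ∘ count>0⇒∈))
  where
  x∉xs : ¬ x ∈ xs
  x∉xs x∈xs with Linked⇒AllPairs <-trans l
  ... | x<xs ∷ _ = <-irrefl refl (All.lookup x<xs x∈xs)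
... | no _ = count-strict≤1 a xs (tail l)

⊇-trans : ∀ {n} {C D E : Column n} → Contains C D → Contains D E → Contains C E
⊇-trans C⊇D D⊇E = C⊇D ∘ D⊇E

∈-entries⇒∈-head : ∀ {n} {a : Letter n} {C T} → Linked Contains (C ∷ T) → a ∈ entries (C ∷ T) → a ∈ C
∈-entries⇒∈-head {C = C} {T} nested a∈T with ∈-concat⁻′ (C ∷ T) a∈T | Linked⇒AllPairs ⊇-trans nested
... | _ , a∈D , here refl | _ = a∈D
... | _ , a∈D , there D∈T | C⊇T ∷ _ = All.lookup C⊇T D∈T a∈D

∈-columnAt-<-count : ∀ {n} (a : Letter n) (T : Tableau n) →
  (∀ {C} → C ∈ T → Linked _<L_ C) → Linked Contains T →
  ∀ c → c < count a (entries T) → Σ (Column n) (λ C → columnAt T c ≡ just C × a ∈ C)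
∈-columnAt-<-count a (C ∷ T) strict nested zero 0<count =
  C , refl , ∈-entries⇒∈-head nested (count>0⇒∈ 0<count)
∈-columnAt-<-count a (C ∷ T) strict nested (suc c) c<count =
  ∈-columnAt-<-count a T (strict ∘ there) (tail nested) c (+-cancelˡ-< 1 c _ 1+c<1+countT)
  where
  1+c<1+countT : suc c < 1 + count a (entries T)
  1+c<1+countT = ≤-trans (subst (suc c <_) (count-++ a C (entries T)) c<count)
                         (+-monoˡ-≤ _ (count-strict≤1 a C (strict (here refl))))

+m-+n≡+k⇒m≡k : ∀ m n k → (0 < m → 0 < n → ⊥) → + m ℤ.- + n ≡ + k → m ≡ k
+m-+n≡+k⇒m≡k m zero k _ eq = +-injective (trans (sym (+-identityʳ (+ m))) eq)
+m-+n≡+k⇒m≡k zero (suc n) k _ ()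
+m-+n≡+k⇒m≡k (suc m) (suc n) k excl _ = ⊥-elim (excl (s≤s z≤n) (s≤s z≤n))

+m-+n≡-k⇒n≡k : ∀ m n k → (0 < m → 0 < n → ⊥) → + m ℤ.- + n ≡ - + k → n ≡ k
+m-+n≡-k⇒n≡k zero n k _ eq = +-injective (neg-injective (trans (sym (+-identityˡ (- + n))) eq))
+m-+n≡-k⇒n≡k (suc m) zero zero _ ()
+m-+n≡-k⇒n≡k (suc m) zero (suc k) _ ()
+m-+n≡-k⇒n≡k (suc m) (suc n) k excl _ = ⊥-elim (excl (s≤s z≤n) (s≤s z≤n))

count-from-weight : ∀ {n} (T : Tableau n) → (∀ i → ¬ (pos i ∈ entries T × neg i ∈ entries T)) →
  ∀ a k → weight T (absL a) ≡ sgn a (+ k) → count a (entries T) ≡ k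
count-from-weight T noBoth (pos i) k =
  +m-+n≡+k⇒m≡k _ _ k (λ p q → noBoth i (count>0⇒∈ p , count>0⇒∈ q))
count-from-weight T noBoth (neg i) k =
  +m-+n≡-k⇒n≡k _ _ k (λ p q → noBoth i (count>0⇒∈ p , count>0⇒∈ q))

act-window : ∀ {n} (σ : SignedPerm n) (v : Fin n → ℤ) j →
  act σ v (absL (window σ j)) ≡ sgn (window σ j) (v j)
act-window (signedPerm π s) v j with s j in sⱼ
... | false rewrite inverseˡ π {j} | sⱼ = refl
... | true rewrite inverseˡ π {j} | sⱼ = refl

proposition2p18 : (n : ℕ) (σ : SignedPerm n) (j : Fin n) (α : Letter n) →
    window σ j ≡ α →
    (T : Tableau n) → IsKeyTableau T → (∀ i → weight T i ≡ act σ (Δ n) i) →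
    ∀ (c : ℕ) → c < n ∸ toℕ j →
    Σ (Column n) (λ C → columnAt T c ≡ just C × α ∈ C)
proposition2p18 n σ j _ refl T ((columns , _) , nested , noBoth) wt c c<n∸j =
  ∈-columnAt-<-count (window σ j) T (proj₂ ∘ columns) nested c (subst (c <_) (sym countα) c<n∸j)
  where
  countα : count (window σ j) (entries T) ≡ n ∸ toℕ j
  countα = count-from-weight T noBoth (window σ j) (n ∸ toℕ j)
             (trans (wt _) (act-window σ (Δ n) j))
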